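{- Let $\tau=(w,x)$ be a pair, $t\in R_\tau$, $p=(i,j)\in X^c_\tau$ and $q=p^\to_{\tau_t}$. Assume that $q\in X^c_\tau$ and that $R^\to_\tau(q)$ is satisfied. If $p^\searrow_{\tau_t}\in X_\tau$ then $P^\downarrow_\tau(p)$ holds. Otherwise, $p^\downarrow_\tau=p^\downarrow_{\tau_t}$ and the conditions $P^\downarrow_\tau(p)$ and $P^\downarrow_{\tau_t}(p)$ are equivalent.
   Context: $S_n$ is the symmetric group on $\{1,\dots,n\}$ with Bruhat order $\le$; $\Box=\{0,\dots,n\}^2$. For $w\in S_n$, $\mathrm{rk}_w(i,j)=\#\{u\le i:w(u)\le j\}$ on $\Box$, and $D_w((i,j),(i',j'))=\mathrm{rk}_w(i,j)+\mathrm{rk}_w(i',j')-\mathrm{rk}_w(i,j')-\mathrm{rk}_w(i',j)$. A pair is $\sigma=(u,v)$ with $v\le u$; $\mathrm{rk}_\sigma=\mathrm{rk}_v-\mathrm{rk}_u$, $X_\sigma=\{p\in\Box:\mathrm{rk}_\sigma(p)=0\}$, $X^c_\sigma=\Box\setminus X_\sigma$. For $\tau=(w,x)$, $R_\tau=\{t\text{ transposition}:x<xt\le w\}$ and $\tau_t=(w,xt)$ for $t\in R_\tau$. For a pair $\sigma=(u,v)$ and $p=(i,j)\in\Box$ with $1\le j\le n-1$: $j^+=\min\{k>j:(i,k)\in X_\sigma\}$, $p^\to_\sigma=(i,j^+)$, $i^+=\max\{l\ge i:(l,j^+)\in X_\sigma,\ D_u(p,(l,j^+))=0\}$, $p^\searrow_\sigma=(i^+,j^+)$,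 $p^\downarrow_\sigma=(i^+,j)$; $P^\downarrow_\sigma(p)$ means $\mathrm{rk}_\sigma(p^\downarrow_\sigma)<\mathrm{rk}_\sigma(p)$. For $p=(i,j)\in X^c_\sigma$: $p^+_\sigma=(\min\{l>i:(l,j)\in X_\sigma\},\min\{l>j:(i,l)\in X_\sigma\})$, and $R^\to_\sigma(p)$ means $D_v(p,p^+_\sigma)=1$. -}

module Defs where

open import Data.Nat as ℕ using (ℕ; zero; suc; _∸_; _<ᵇ_)
open import Data.Integer as ℤ using (ℤ; +_; _-_)
open import Data.Fin using (Fin; toℕ)
open import Data.Fin.Permutation using (Permutation′; _⟨$⟩ʳ_; _∘ₚ_; transpose)
open import Data.List using (List; map; allFin)
open import Data.Nat.ListAction using (sum)
open import Data.Bool using (Bool; true; false; if_then_else_; _∧_)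
open import Data.Product using (_×_; _,_; proj₁; proj₂)
open import Relation.Nullary using (¬_)
open import Relation.Nullary.Decidable using (⌊_⌋)
open import Relation.Binary.PropositionalEquality using (_≡_)

-- Elements of S_n: bijections of Fin n (Fin n = {0,..,n-1} encodes {1,..,n}).
Perm : ℕ → Set
Perm = Permutation′

Point : Set
Point = ℕ × ℕ

InBox : ℕ → Point → Set
InBox n (i , j) = (i ℕ.≤ n) × (j ℕ.≤ n)

-- rk_w(i,j) = #{u ≤ i : w(u) ≤ j} (1-indexed); with 0-indexed a = u-1
-- the condition u ≤ i is toℕ a < i, and w(u) ≤ j is toℕ (w a) < j.
rk : ∀ {n} → Perm n → Point → ℕ
rk {n} w (i , j) =
  sum (map (λ a → if (toℕ a <ᵇ i) ∧ (toℕ (w ⟨$⟩ʳ a) <ᵇ j) then 1 else 0) (allFin n))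

rkℤ : ∀ {n} → Perm n → Point → ℤ
rkℤ w p = + rk w p

D : ∀ {n} → Perm n → Point → Point → ℤ
D w (i , j) (i' , j') =
  (rkℤ w (i , j) ℤ.+ rkℤ w (i' , j')) - rkℤ w (i , j') - rkℤ w (i' , j)

-- Bruhat order v ≤ u via the rank-matrix (tableau) criterion:
-- v ≤ u  iff  rk_u(p) ≤ rk_v(p) for all p ∈ □.
_≤B_ : ∀ {n} → Perm n → Perm n → Set
_≤B_ {n} v u = ∀ p → InBox n p → rk u p ℕ.≤ rk v p

_<B_ : ∀ {n} → Perm n → Perm n → Set
_<B_ {n} v u = v ≤B u × ¬ (∀ a → v ⟨$⟩ʳ a ≡ u ⟨$⟩ʳ a)

record Pair (n : ℕ) : Set where
  constructor pair
  field
    u : Perm n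
    v : Perm n
    v≤u : v ≤B u
open Pair public

rkσ : ∀ {n} → Pair n → Point → ℤ
rkσ σ p = rkℤ (v σ) p - rkℤ (u σ) p

InX : ∀ {n} → Pair n → Point → Set
InX σ p = rkσ σ p ≡ + 0

inXᵇ : ∀ {n} → Pair n → Point → Bool
inXᵇ σ p = ⌊ rkσ σ p ℤ.≟ + 0 ⌋

-- x t for the transposition t = (a b): (x t)(k) = x(t(k)).
_·t[_,_] : ∀ {n} → Perm n → Fin n → Fin n → Perm n
x ·t[ a , b ] = transpose a b ∘ₚ x

-- t = (a b) ∈ R_τ for τ = (w , x):  x < x t ≤ w
InR : ∀ {n} → Pair n → Fin n → Fin n → Set
InR τ a b = (v τ <B (v τ ·t[ a , b ])) × ((v τ ·t[ a , b ]) ≤B u τ)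

τ[_,_] : ∀ {n} (τ : Pair n) (a b : Fin n) → InR τ a b → Pair n
τ[ τ , a ] b r = pair (u τ) (v τ ·t[ a , b ]) (proj₂ r)

firstIn : (ℕ → Bool) → ℕ → ℕ → ℕ → ℕ
firstIn P d k zero = d
firstIn P d k (suc m) = if P k then k else firstIn P d (suc k) m

lastIn : (ℕ → Bool) → ℕ → ℕ → ℕ → ℕ
lastIn P d k zero = d
lastIn P d k (suc m) = if P k then k else lastIn P d (k ∸ 1) m

-- j⁺ = min{k > j : (i,k) ∈ X_σ}  (search over j < k ≤ n; nonempty since (i,n) ∈ X_σ)
jplus : ∀ {n} → Pair n → Point → ℕ
jplus {n} σ (i , j) = firstIn (λ k → inXᵇ σ (i , k)) n (suc j) (n ∸ j)

pto : ∀ {n} → Pair n → Point → Point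
pto σ (i , j) = (i , jplus σ (i , j))

-- i⁺ = max{l ≥ i : (l,j⁺) ∈ X_σ, D_u(p,(l,j⁺)) = 0}  (search over i ≤ l ≤ n;
-- nonempty since l = i qualifies)
iplus : ∀ {n} → Pair n → Point → ℕ
iplus {n} σ (i , j) =
  lastIn (λ l → inXᵇ σ (l , j⁺) ∧ ⌊ D (u σ) (i , j) (l , j⁺) ℤ.≟ + 0 ⌋) i n (suc (n ∸ i))
  where j⁺ = jplus σ (i , j)

pse : ∀ {n} → Pair n → Point → Point
pse σ p = (iplus σ p , jplus σ p)

pdown : ∀ {n} → Pair n → Point → Point
pdown σ (i , j) = (iplus σ (i , j) , j)

Pdown : ∀ {n} → Pair n → Point → Set
Pdown σ p = rkσ σ (pdown σ p) ℤ.< rkσ σ p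

pplus : ∀ {n} → Pair n → Point → Point
pplus {n} σ (i , j) =
  ( firstIn (λ l → inXᵇ σ (l , j)) n (suc i) (n ∸ i)
  , firstIn (λ l → inXᵇ σ (i , l)) n (suc j) (n ∸ j) )

Rto : ∀ {n} → Pair n → Point → Set
Rto σ p = D (v σ) p (pplus σ p) ≡ + 1

{-# OPTIONS --safe #-}
-- Write x′ = x t.  Since x < x t, the difference rk_x − rk_{x′} at (l,k) is the product of the
-- indicators "l separates a, b" and "k separates x a, x b"; hence rk_τ = rk_{τ_t} + δ with
-- δ ∈ {0,1}, and X_τ ⊆ X_{τ_t}.  The rest is read off the rectangle identity
--   rk_σ(i,j) + rk_σ(l,k) − rk_σ(i,k) − rk_σ(l,j) = D_v − D_u
-- together with nonnegativity of rk_σ on □ and of D on rectangles.  Put q = (i,j⁺) and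
-- q⁺_τ = (i′,j′).  The column search of τ from p stops at j′, and i⁺_τ ≤ i⁺_{τ_t}.  If
-- p↘_{τ_t} ∈ X_τ, then i′ ≤ i⁺_τ, and the drop rk_τ(p) − rk_τ(p↓_τ) equals D_x(p,(i⁺_τ,j′)),
-- whose rectangle contains the one of R→_τ(q), so the drop is at least 1.  Otherwise
-- δ = 1 at p↘_{τ_t}, so D_x exceeds D_{x′} by 1 on the rectangle from p↘_{τ_t} to q⁺_τ; this
-- forces i⁺_{τ_t} ≤ i⁺_τ, and on the common row the summand δ(i⁺,j) = δ(i,j) cancels from
-- both drops.
module Submission where

open import Defs
open import Algebra.Properties.CommutativeSemigroup as CommutativeSemigroup using ()
open import Data.Bool using (Bool; true; false; T; _∧_; _xor_; if_then_else_)
open import Data.Bool.Properties using (T-∧; T-≡; xor-comm)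
open import Data.Empty using (⊥-elim)
open import Data.Fin as Fin using (Fin; toℕ; zero; suc)
open import Data.Fin.Properties using (_≟_; toℕ<n)
open import Data.Fin.Permutation using (_⟨$⟩ʳ_)
import Data.Fin.Permutation.Components as Components
open import Data.Integer as ℤ using (ℤ; +_; 0ℤ; 1ℤ; _+_; _-_)
import Data.Integer.Properties as ℤ
open import Data.Integer.Tactic.RingSolver using (solve-∀)
open import Data.List using (List; []; _∷_; map; allFin)
open import Data.List.Properties using (map-cong; map-tabulate)
open import Data.Nat as ℕ using (ℕ; zero; suc; _∸_; _≤_; _<_; _<ᵇ_; z≤n; s≤s)
import Data.Nat.Properties as ℕ
open import Data.Nat.ListAction using (sum)
open import Data.Product using (_×_; _,_; proj₁; proj₂)
open import Data.Sum using (_⊎_; inj₁; inj₂)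
open import Function using (_∘_; id)
open import Function.Bundles using (_⇔_; mk⇔; Equivalence)
open import Relation.Binary.Definitions using (tri<; tri≈; tri>)
open import Relation.Binary.PropositionalEquality
  using (_≡_; _≢_; _≗_; refl; sym; trans; cong; cong₂; subst; subst₂; module ≡-Reasoning)
open import Relation.Nullary using (¬_; yes; no; does; contradiction)
open import Relation.Nullary.Decidable using (T?; ⌊_⌋; toWitness; fromWitness; dec-true; dec-false)

open Equivalence using (to; from)
open CommutativeSemigroup ℕ.+-commutativeSemigroup using (interchange; x∙yz≈y∙xz)

𝟙[_] : Bool → ℕ
𝟙[ b ] = if b then 1 else 0

𝟙-T : ∀ {b} → T b → 𝟙[ b ] ≡ 1
𝟙-T {true} _ = refl

𝟙-¬T : ∀ {b} → ¬ T b → 𝟙[ b ] ≡ 0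
𝟙-¬T {true}  ¬b = ⊥-elim (¬b _)
𝟙-¬T {false} _  = refl

+𝟙≡0⇒¬T : ∀ {b} → + 𝟙[ b ] ≡ 0ℤ → ¬ T b
+𝟙≡0⇒¬T {true} ()

𝟙-mono : ∀ {b c} → (T b → T c) → 𝟙[ b ] ≤ 𝟙[ c ]
𝟙-mono {false}         _   = z≤n
𝟙-mono {true}  {true}  _   = ℕ.≤-refl
𝟙-mono {true}  {false} b⇒c = ⊥-elim (b⇒c _)

𝟙-rearrangement : ∀ {A₁ A₂ B₁ B₂} → (T A₁ → T A₂) → (T B₁ → T B₂) →
  𝟙[ A₁ ∧ B₂ ] ℕ.+ 𝟙[ A₂ ∧ B₁ ] ≤ 𝟙[ A₁ ∧ B₁ ] ℕ.+ 𝟙[ A₂ ∧ B₂ ]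
𝟙-rearrangement {true}  {true}  {B₁} {B₂} _ _ = ℕ.≤-reflexive (ℕ.+-comm 𝟙[ B₂ ] 𝟙[ B₁ ])
𝟙-rearrangement {true}  {false} A₁⇒A₂ _     = ⊥-elim (A₁⇒A₂ _)
𝟙-rearrangement {false} {false} _     _     = z≤n
𝟙-rearrangement {false} {true}  _     B₁⇒B₂ = 𝟙-mono B₁⇒B₂

T⇒≡true : ∀ {b} → T b → b ≡ true
T⇒≡true = to T-≡

xor-convex : ∀ {p₁ p₂ p₃ q₁ q₂ q₃} →
  (T p₁ → T p₂) → (T p₂ → T p₃) → (T q₁ → T q₂) → (T q₂ → T q₃) →
  T (p₁ xor q₁) → T (p₃ xor q₃) → T (p₂ xor q₂)
xor-convex {p₂ = true}  {q₂ = false} _ _ _ _ _ _ = _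
xor-convex {p₂ = false} {q₂ = true}  _ _ _ _ _ _ = _
xor-convex {p₂ = true}  {false} {q₂ = true}         _     p₂⇒p₃ _     _     _ _  = ⊥-elim (p₂⇒p₃ _)
xor-convex {p₂ = true}  {true}  {q₂ = true} {false} _     _     _     q₂⇒q₃ _ _  = ⊥-elim (q₂⇒q₃ _)
xor-convex {p₂ = true}  {true}  {q₂ = true} {true}  _     _     _     _     _ ()
xor-convex {true}  {false} {q₂ = false}             p₁⇒p₂ _     _     _     _ _  = ⊥-elim (p₁⇒p₂ _)
xor-convex {false} {false} {q₁ = true}  {false}     _     _     q₁⇒q₂ _     _ _  = ⊥-elim (q₁⇒q₂ _)
xor-convex {false} {false} {q₁ = false} {false}     _     _     _     _     () _

<ᵇ-mono : ∀ c {l k} → l ≤ k → T (c <ᵇ l) → T (c <ᵇ k)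
<ᵇ-mono c {l} l≤k c<l = ℕ.<⇒<ᵇ (ℕ.<-≤-trans (ℕ.<ᵇ⇒< c l c<l) l≤k)

separates : ∀ {n} → Fin n → Fin n → ℕ → Bool
separates a b l = (toℕ a <ᵇ l) xor (toℕ b <ᵇ l)

separates-convex : ∀ {n} {a b : Fin n} {i l k} → i ≤ l → l ≤ k →
  T (separates a b i) → T (separates a b k) → T (separates a b l)
separates-convex {a = a} {b} i≤l l≤k =
  xor-convex (<ᵇ-mono (toℕ a) i≤l) (<ᵇ-mono (toℕ a) l≤k) (<ᵇ-mono (toℕ b) i≤l) (<ᵇ-mono (toℕ b) l≤k)

separates-last : ∀ {n} (a b : Fin n) → ¬ T (separates a b n)
separates-last a b
  rewrite T⇒≡true (ℕ.<⇒<ᵇ (toℕ<n a)) | T⇒≡true (ℕ.<⇒<ᵇ (toℕ<n b)) = λ ()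

sum-map-+ : ∀ {A : Set} (f g : A → ℕ) (xs : List A) →
  sum (map (λ x → f x ℕ.+ g x) xs) ≡ sum (map f xs) ℕ.+ sum (map g xs)
sum-map-+ f g []       = refl
sum-map-+ f g (x ∷ xs) =
  trans (cong (f x ℕ.+ g x ℕ.+_) (sum-map-+ f g xs)) (interchange (f x) (g x) _ _)

sum-map-mono : ∀ {A : Set} {f g : A → ℕ} → (∀ x → f x ≤ g x) → (xs : List A) →
  sum (map f xs) ≤ sum (map g xs)
sum-map-mono f≤g []       = z≤n
sum-map-mono f≤g (x ∷ xs) = ℕ.+-mono-≤ (f≤g x) (sum-map-mono f≤g xs)

-- rk w (i , j) is definitionally ∑ λ c → 𝟙[ (toℕ c <ᵇ i) ∧ (toℕ (w ⟨$⟩ʳ c) <ᵇ j) ].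
∑ : ∀ {n} → (Fin n → ℕ) → ℕ
∑ {n} f = sum (map f (allFin n))

∑-cong : ∀ {n} {f g : Fin n → ℕ} → f ≗ g → ∑ f ≡ ∑ g
∑-cong {n} f≗g = cong sum (map-cong f≗g (allFin n))

∑-suc : ∀ {n} (f : Fin (suc n) → ℕ) → ∑ f ≡ f zero ℕ.+ ∑ (f ∘ Fin.suc)
∑-suc f = cong (λ xs → f zero ℕ.+ sum xs)
  (trans (map-tabulate Fin.suc f) (sym (map-tabulate id (f ∘ Fin.suc))))

∑-zero : ∀ n → ∑ {n} (λ _ → 0) ≡ 0
∑-zero zero    = refl
∑-zero (suc n) = trans (∑-suc {n} (λ _ → 0)) (∑-zero n)

single : ∀ {n} → Fin n → ℕ → Fin n → ℕ
single a m c = if does (c ≟ a) then m else 0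

∑-single : ∀ {n} (a : Fin n) (m : ℕ) → ∑ (single a m) ≡ m
∑-single {suc n} zero    m =
  trans (∑-suc {n} (single zero m)) (trans (cong (m ℕ.+_) (∑-zero n)) (ℕ.+-identityʳ m))
∑-single {suc n} (suc a) m = trans (∑-suc {n} (single (suc a) m)) (∑-single a m)

∑-exchange : ∀ {n} {a b : Fin n} → a ≢ b → (f g : Fin n → ℕ) →
  (∀ c → c ≢ a → c ≢ b → f c ≡ g c) →
  ∑ f ℕ.+ (g a ℕ.+ g b) ≡ ∑ g ℕ.+ (f a ℕ.+ f b)
∑-exchange {n} {a} {b} a≢b f g f≡g = begin
  ∑ f ℕ.+ (g a ℕ.+ g b)                                        ≡⟨ add-singles f (g a) (g b) ⟩
  ∑ (λ c → f c ℕ.+ (single a (g a) c ℕ.+ single b (g b) c))  ≡⟨ ∑-cong swap ⟩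
  ∑ (λ c → g c ℕ.+ (single a (f a) c ℕ.+ single b (f b) c))  ≡⟨ add-singles g (f a) (f b) ⟨
  ∑ g ℕ.+ (f a ℕ.+ f b)                                        ∎
  where
  open ≡-Reasoning
  add-singles : ∀ h x y → ∑ h ℕ.+ (x ℕ.+ y) ≡ ∑ (λ c → h c ℕ.+ (single a x c ℕ.+ single b y c))
  add-singles h x y = begin
    ∑ h ℕ.+ (x ℕ.+ y)
      ≡⟨ cong (∑ h ℕ.+_) (cong₂ ℕ._+_ (∑-single a x) (∑-single b y)) ⟨
    ∑ h ℕ.+ (∑ (single a x) ℕ.+ ∑ (single b y))
      ≡⟨ cong (∑ h ℕ.+_) (sum-map-+ (single a x) (single b y) (allFin n)) ⟨
    ∑ h ℕ.+ ∑ (λ c → single a x c ℕ.+ single b y c)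
      ≡⟨ sum-map-+ h (λ c → single a x c ℕ.+ single b y c) (allFin n) ⟨
    ∑ (λ c → h c ℕ.+ (single a x c ℕ.+ single b y c))  ∎
  swap : ∀ c → f c ℕ.+ (single a (g a) c ℕ.+ single b (g b) c)
             ≡ g c ℕ.+ (single a (f a) c ℕ.+ single b (f b) c)
  swap c with c ≟ a | c ≟ b
  ... | yes refl | yes refl = contradiction refl a≢b
  ... | yes refl | no _     = x∙yz≈y∙xz (f a) (g a) 0
  ... | no _     | yes refl = ℕ.+-comm (f b) (g b)
  ... | no c≢a   | no c≢b   = cong (ℕ._+ 0) (f≡g c c≢a c≢b)

transpose-fixes : ∀ {n} {a b c : Fin n} → c ≢ a → c ≢ b → Components.transpose a b c ≡ c
transpose-fixes {a = a} {b} {c} c≢a c≢b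
  rewrite dec-false (c ≟ a) c≢a | dec-false (c ≟ b) c≢b = refl

transpose-sends-left : ∀ {n} (a b : Fin n) → Components.transpose a b a ≡ b
transpose-sends-left a b rewrite dec-true (a ≟ a) refl = refl

transpose-sends-right : ∀ {n} {a b : Fin n} → a ≢ b → Components.transpose a b b ≡ a
transpose-sends-right {a = a} {b} a≢b
  rewrite dec-false (b ≟ a) (a≢b ∘ sym) | dec-true (b ≟ b) refl = refl

private
  cancel-same : ∀ {X X′} c → X′ ℕ.+ c ≡ X ℕ.+ c → X ≡ X′ ℕ.+ 0
  cancel-same {X} {X′} c e = trans (sym (ℕ.+-cancelʳ-≡ c X′ X e)) (sym (ℕ.+-identityʳ X′))

  one-sided-defect : ∀ {X X′} B₁ B₂ → X′ ℕ.+ 𝟙[ B₁ ] ≡ X ℕ.+ 𝟙[ B₂ ] → X′ ≤ X →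
    X ≡ X′ ℕ.+ 𝟙[ B₁ xor B₂ ]
  one-sided-defect true  true  e _ = cancel-same 1 e
  one-sided-defect false false e _ = cancel-same 0 e
  one-sided-defect {X} true false e _ = trans (sym (ℕ.+-identityʳ X)) (sym e)
  one-sided-defect {X} {X′} false true e X′≤X =
    ⊥-elim (ℕ.m+1+n≰m X (subst (_≤ X) (trans (sym (ℕ.+-identityʳ X′)) e) X′≤X))

transposition-defect : ∀ {X X′ : ℕ} A₁ A₂ B₁ B₂ →
  X′ ℕ.+ (𝟙[ A₁ ∧ B₁ ] ℕ.+ 𝟙[ A₂ ∧ B₂ ]) ≡ X ℕ.+ (𝟙[ A₁ ∧ B₂ ] ℕ.+ 𝟙[ A₂ ∧ B₁ ]) → X′ ≤ X →
  X ≡ X′ ℕ.+ 𝟙[ (A₁ xor A₂) ∧ (B₁ xor B₂) ]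
transposition-defect {X} true true B₁ B₂ e _ =
  cancel-same (𝟙[ B₁ ] ℕ.+ 𝟙[ B₂ ]) (trans e (cong (X ℕ.+_) (ℕ.+-comm 𝟙[ B₂ ] 𝟙[ B₁ ])))
transposition-defect false false _ _ e _ = cancel-same 0 e
transposition-defect {X} {X′} true false B₁ B₂ e = one-sided-defect B₁ B₂
  (trans (cong (X′ ℕ.+_) (sym (ℕ.+-identityʳ 𝟙[ B₁ ])))
         (trans e (cong (X ℕ.+_) (ℕ.+-identityʳ 𝟙[ B₂ ]))))
transposition-defect {X} {X′} false true B₁ B₂ e X′≤X =
  subst (λ s → X ≡ X′ ℕ.+ 𝟙[ s ]) (xor-comm B₂ B₁) (one-sided-defect B₂ B₁ e X′≤X)

rk-·t : ∀ {n} (x : Perm n) {a b : Fin n} → a ≢ b → ∀ {l k} →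
  rk (x ·t[ a , b ]) (l , k) ≤ rk x (l , k) →
  rk x (l , k) ≡ rk (x ·t[ a , b ]) (l , k) ℕ.+ 𝟙[ separates a b l ∧ separates (x ⟨$⟩ʳ a) (x ⟨$⟩ʳ b) k ]
rk-·t {n} x {a} {b} a≢b {l} {k} =
  transposition-defect (toℕ a <ᵇ l) (toℕ b <ᵇ l) (toℕ (x ⟨$⟩ʳ a) <ᵇ k) (toℕ (x ⟨$⟩ʳ b) <ᵇ k) exchange
  where
  counts : Fin n → Fin n → ℕ
  counts c d = 𝟙[ (toℕ c <ᵇ l) ∧ (toℕ (x ⟨$⟩ʳ d) <ᵇ k) ]
  t : Fin n → Fin n
  t = Components.transpose a b
  exchange : rk (x ·t[ a , b ]) (l , k) ℕ.+ (counts a a ℕ.+ counts b b)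
           ≡ rk x (l , k) ℕ.+ (counts a b ℕ.+ counts b a)
  exchange = trans
    (∑-exchange a≢b (λ c → counts c (t c)) (λ c → counts c c)
      (λ c c≢a c≢b → cong (counts c) (transpose-fixes c≢a c≢b)))
    (cong (rk x (l , k) ℕ.+_) (cong₂ ℕ._+_ (cong (counts a) (transpose-sends-left a b))
                                            (cong (counts b) (transpose-sends-right a≢b))))

rk-rectangle : ∀ {n} (w : Perm n) {i j l k} → i ≤ l → j ≤ k →
  rk w (i , k) ℕ.+ rk w (l , j) ≤ rk w (i , j) ℕ.+ rk w (l , k)
rk-rectangle {n} w i≤l j≤k = subst₂ _≤_ (sum-map-+ _ _ (allFin n)) (sum-map-+ _ _ (allFin n))
  (sum-map-mono (λ c → 𝟙-rearrangement (<ᵇ-mono (toℕ c) i≤l) (<ᵇ-mono (toℕ (w ⟨$⟩ʳ c)) j≤k)) (allFin n))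

rk-lastColumn : ∀ {n} (w w′ : Perm n) i → rk w (i , n) ≡ rk w′ (i , n)
rk-lastColumn {n} w w′ i = ∑-cong λ c →
  cong (λ s → 𝟙[ (toℕ c <ᵇ i) ∧ s ]) (trans (below-n (w ⟨$⟩ʳ c)) (sym (below-n (w′ ⟨$⟩ʳ c))))
  where
  below-n : (c : Fin n) → (toℕ c <ᵇ n) ≡ true
  below-n c = T⇒≡true (ℕ.<⇒<ᵇ (toℕ<n c))

+-nonneg-≡0 : ∀ {a b} → 0ℤ ℤ.≤ a → 0ℤ ℤ.≤ b → a + b ≡ 0ℤ → a ≡ 0ℤ × b ≡ 0ℤ
+-nonneg-≡0 {a} {b} 0≤a 0≤b a+b≡0 =
  a≡0 , trans (sym (ℤ.+-identityˡ b)) (trans (cong (_+ b) (sym a≡0)) a+b≡0)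
  where
  a≡0 : a ≡ 0ℤ
  a≡0 = ℤ.≤-antisym (subst₂ ℤ._≤_ (ℤ.+-identityʳ a) a+b≡0 (ℤ.+-monoʳ-≤ a 0≤b)) 0≤a

nonneg-summand≡0 : ∀ {a b c} → 0ℤ ℤ.≤ a → 0ℤ ℤ.≤ b → a + (b + c) ≡ c → a ≡ 0ℤ
nonneg-summand≡0 {a} {b} {c} 0≤a 0≤b a+b+c≡c = proj₁ (+-nonneg-≡0 0≤a 0≤b (begin
  a + b              ≡⟨ identity a b c ⟩
  (a + (b + c)) - c  ≡⟨ cong (_- c) a+b+c≡c ⟩
  c - c              ≡⟨ ℤ.+-inverseʳ c ⟩
  0ℤ                 ∎))
  where
  open ≡-Reasoning
  identity : ∀ a b c → a + b ≡ (a + (b + c)) - c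
  identity = solve-∀

≤-+-nonnegˡ : ∀ {a b} → 0ℤ ℤ.≤ a → b ℤ.≤ a + b
≤-+-nonnegˡ {a} {b} 0≤a = subst (ℤ._≤ a + b) (ℤ.+-identityˡ b) (ℤ.+-monoˡ-≤ b 0≤a)

≤-+-nonnegʳ : ∀ {a b} → 0ℤ ℤ.≤ b → a ℤ.≤ a + b
≤-+-nonnegʳ {a} {b} 0≤b = subst (ℤ._≤ a + b) (ℤ.+-identityʳ a) (ℤ.+-monoʳ-≤ a 0≤b)

+-cancelʳ-<-⇔ : ∀ c {a b} → (a + c ℤ.< b + c) ⇔ (a ℤ.< b)
+-cancelʳ-<-⇔ c {a} {b} = mk⇔ (subst₂ ℤ._<_ (undo a) (undo b) ∘ ℤ.+-monoˡ-< (ℤ.- c)) (ℤ.+-monoˡ-< c)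
  where
  undo : ∀ x → (x + c) + ℤ.- c ≡ x
  undo x = trans (ℤ.+-assoc x c (ℤ.- c)) (trans (cong (_+_ x) (ℤ.+-inverseʳ c)) (ℤ.+-identityʳ x))

-- D w p q is definitionally rect (rkℤ w) p q.
rect : (Point → ℤ) → Point → Point → ℤ
rect f (i , j) (l , k) = (f (i , j) + f (l , k)) - f (i , k) - f (l , j)

rect-splitCol : ∀ f {i j l k} k′ →
  rect f (i , j) (l , k) ≡ rect f (i , j) (l , k′) + rect f (i , k′) (l , k)
rect-splitCol f {i} {j} {l} {k} k′ =
  identity (f (i , j)) (f (l , k)) (f (i , k)) (f (l , j)) (f (l , k′)) (f (i , k′))
  where
  identity : ∀ a b c d e g → (a + b) - c - d ≡ ((a + e) - g - d) + ((g + b) - c - e)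
  identity = solve-∀

rect-splitRow : ∀ f {i j l k} l′ →
  rect f (i , j) (l , k) ≡ rect f (i , j) (l′ , k) + rect f (l′ , j) (l , k)
rect-splitRow f {i} {j} {l} {k} l′ =
  identity (f (i , j)) (f (l , k)) (f (i , k)) (f (l , j)) (f (l′ , k)) (f (l′ , j))
  where
  identity : ∀ a b c d e g → (a + b) - c - d ≡ ((a + e) - c - g) + ((g + b) - e - d)
  identity = solve-∀

rect-sameRow : ∀ f i j k → rect f (i , j) (i , k) ≡ 0ℤ
rect-sameRow f i j k = identity (f (i , j)) (f (i , k))
  where
  identity : ∀ a c → (a + c) - c - a ≡ 0ℤ
  identity = solve-∀

rect-shift : ∀ {n} {f g : Point → ℤ} (h : Point → ℤ) → (∀ {p} → InBox n p → f p ≡ g p + h p) →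
  ∀ {i j l k} → InBox n (i , j) → InBox n (l , k) →
  rect f (i , j) (l , k) ≡ rect g (i , j) (l , k) + rect h (i , j) (l , k)
rect-shift {g = g} h f≡g+h {i} {j} {l} {k} (i≤n , j≤n) (l≤n , k≤n)
  rewrite f≡g+h (i≤n , j≤n) | f≡g+h (l≤n , k≤n) | f≡g+h (i≤n , k≤n) | f≡g+h (l≤n , j≤n) =
  identity (g (i , j)) (g (l , k)) (g (i , k)) (g (l , j)) (h (i , j)) (h (l , k)) (h (i , k)) (h (l , j))
  where
  identity : ∀ a b c d a′ b′ c′ d′ →
    ((a + a′) + (b + b′)) - (c + c′) - (d + d′) ≡ ((a + b) - c - d) + ((a′ + b′) - c′ - d′)
  identity = solve-∀

D-nonneg : ∀ {n} (w : Perm n) {i j l k} → i ≤ l → j ≤ k → 0ℤ ℤ.≤ D w (i , j) (l , k)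
D-nonneg w {i} {j} {l} {k} i≤l j≤k =
  subst (0ℤ ℤ.≤_) (regroup (rk w (i , j)) (rk w (l , k)) (rk w (i , k)) (rk w (l , j)))
    (ℤ.i≤j⇒0≤j-i (ℤ.+≤+ (rk-rectangle w i≤l j≤k)))
  where
  identity : ∀ a b c d → (a + b) - (c + d) ≡ (a + b) - c - d
  identity = solve-∀
  regroup : ∀ a b c d → + (a ℕ.+ b) - + (c ℕ.+ d) ≡ (+ a + + b) - + c - + d
  regroup a b c d rewrite ℤ.pos-+ a b | ℤ.pos-+ c d = identity (+ a) (+ b) (+ c) (+ d)

D-mono : ∀ {n} (w : Perm n) {i j l k i′ j′ l′ k′} →
  i ≤ i′ → j ≤ j′ → i′ ≤ l′ → j′ ≤ k′ → l′ ≤ l → k′ ≤ k →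
  D w (i′ , j′) (l′ , k′) ℤ.≤ D w (i , j) (l , k)
D-mono w {i} {j} {l} {k} {i′} {j′} {l′} {k′} i≤i′ j≤j′ i′≤l′ j′≤k′ l′≤l k′≤k = begin
  D w (i′ , j′) (l′ , k′)                           ≤⟨ ≤-+-nonnegˡ (D-nonneg w i≤i′ j′≤k′) ⟩
  D w (i , j′) (i′ , k′) + D w (i′ , j′) (l′ , k′)  ≡⟨ rect-splitRow (rkℤ w) {i} {j′} {l′} {k′} i′ ⟨
  D w (i , j′) (l′ , k′)                            ≤⟨ ≤-+-nonnegˡ (D-nonneg w i≤l′ j≤j′) ⟩
  D w (i , j) (l′ , j′) + D w (i , j′) (l′ , k′)    ≡⟨ rect-splitCol (rkℤ w) {i} {j} {l′} {k′} j′ ⟨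
  D w (i , j) (l′ , k′)                             ≤⟨ ≤-+-nonnegʳ (D-nonneg w l′≤l j≤k′) ⟩
  D w (i , j) (l′ , k′) + D w (l′ , j) (l , k′)     ≡⟨ rect-splitRow (rkℤ w) {i} {j} {l} {k′} l′ ⟨
  D w (i , j) (l , k′)                              ≤⟨ ≤-+-nonnegʳ (D-nonneg w i≤l k′≤k) ⟩
  D w (i , j) (l , k′) + D w (i , k′) (l , k)       ≡⟨ rect-splitCol (rkℤ w) {i} {j} {l} {k} k′ ⟨
  D w (i , j) (l , k)                               ∎
  where
  open ℤ.≤-Reasoning
  i≤l′ : i ≤ l′
  i≤l′ = ℕ.≤-trans i≤i′ i′≤l′
  i≤l : i ≤ l
  i≤l = ℕ.≤-trans i≤l′ l′≤l
  j≤k′ : j ≤ k′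
  j≤k′ = ℕ.≤-trans j≤j′ j′≤k′

D-≡0-splitCol : ∀ {n} (w : Perm n) {i j l k} k′ → i ≤ l → j ≤ k′ → k′ ≤ k →
  D w (i , j) (l , k) ≡ 0ℤ ⇔ (D w (i , j) (l , k′) ≡ 0ℤ × D w (i , k′) (l , k) ≡ 0ℤ)
D-≡0-splitCol w {i} {j} {l} {k} k′ i≤l j≤k′ k′≤k = mk⇔
  (λ D≡0 → +-nonneg-≡0 (D-nonneg w i≤l j≤k′) (D-nonneg w i≤l k′≤k) (trans (sym split) D≡0))
  (λ { (left≡0 , right≡0) → trans split (cong₂ _+_ left≡0 right≡0) })
  where
  split : D w (i , j) (l , k) ≡ D w (i , j) (l , k′) + D w (i , k′) (l , k)
  split = rect-splitCol (rkℤ w) {i} {j} {l} {k} k′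

D-≡0-splitRow : ∀ {n} (w : Perm n) {i j l k} l′ → i ≤ l′ → l′ ≤ l → j ≤ k →
  D w (i , j) (l , k) ≡ 0ℤ ⇔ (D w (i , j) (l′ , k) ≡ 0ℤ × D w (l′ , j) (l , k) ≡ 0ℤ)
D-≡0-splitRow w {i} {j} {l} {k} l′ i≤l′ l′≤l j≤k = mk⇔
  (λ D≡0 → +-nonneg-≡0 (D-nonneg w i≤l′ j≤k) (D-nonneg w l′≤l j≤k) (trans (sym split) D≡0))
  (λ { (top≡0 , bottom≡0) → trans split (cong₂ _+_ top≡0 bottom≡0) })
  where
  split : D w (i , j) (l , k) ≡ D w (i , j) (l′ , k) + D w (l′ , j) (l , k)
  split = rect-splitRow (rkℤ w) {i} {j} {l} {k} l′

rkσ-nonneg : ∀ {n} (σ : Pair n) {p} → InBox n p → 0ℤ ℤ.≤ rkσ σ p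
rkσ-nonneg σ {p} p∈□ = ℤ.i≤j⇒0≤j-i (ℤ.+≤+ (v≤u σ p p∈□))

InX-lastColumn : ∀ {n} (σ : Pair n) i → InX σ (i , n)
InX-lastColumn σ i = ℤ.i≡j⇒i-j≡0 (cong +_ (rk-lastColumn (v σ) (u σ) i))

rect-rkσ : ∀ {n} (σ : Pair n) i j l k →
  rect (rkσ σ) (i , j) (l , k) ≡ D (v σ) (i , j) (l , k) - D (u σ) (i , j) (l , k)
rect-rkσ σ i j l k =
  identity (rkℤ (v σ) (i , j)) (rkℤ (v σ) (l , k)) (rkℤ (v σ) (i , k)) (rkℤ (v σ) (l , j))
           (rkℤ (u σ) (i , j)) (rkℤ (u σ) (l , k)) (rkℤ (u σ) (i , k)) (rkℤ (u σ) (l , j))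
  where
  identity : ∀ a b c d e f g h →
    ((a - e) + (b - f)) - (c - g) - (d - h) ≡ ((a + b) - c - d) - ((e + f) - g - h)
  identity = solve-∀

private
  corner-identity : ∀ A B E P Q {C} → (A + B) - C - E ≡ P - Q → C ≡ 0ℤ → (E + P) - A ≡ B + Q
  corner-identity A B E P Q rect≡ refl = begin
    (E + P) - A                                  ≡⟨ regroup A B E P Q ⟩
    (B + Q) + ((P - Q) - ((A + B) - 0ℤ - E))     ≡⟨ cong (λ z → (B + Q) + ((P - Q) - z)) rect≡ ⟩
    (B + Q) + ((P - Q) - (P - Q))                ≡⟨ cancel (B + Q) (P - Q) ⟩
    B + Q                                        ∎
    where
    open ≡-Reasoning
    regroup : ∀ A B E P Q → (E + P) - A ≡ (B + Q) + ((P - Q) - ((A + B) - 0ℤ - E))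
    regroup = solve-∀
    cancel : ∀ x y → x + (y - y) ≡ x
    cancel = solve-∀

corner⇔ : ∀ {n} (σ : Pair n) {i j l k} → i ≤ l → j ≤ k → InBox n (l , k) → InX σ (i , k) →
  (InX σ (l , k) × D (u σ) (i , j) (l , k) ≡ 0ℤ)
    ⇔ (rkσ σ (l , j) + D (v σ) (i , j) (l , k) ≡ rkσ σ (i , j))
corner⇔ σ {i} {j} {l} {k} i≤l j≤k lk∈□ ik∈X = mk⇔
  (λ { (lk∈X , Du≡0) → ℤ.i-j≡0⇒i≡j _ _ (trans key (cong₂ _+_ lk∈X Du≡0)) })
  (λ eq → +-nonneg-≡0 (rkσ-nonneg σ lk∈□) (D-nonneg (u σ) i≤l j≤k) (trans (sym key) (ℤ.i≡j⇒i-j≡0 eq)))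
  where
  key : (rkσ σ (l , j) + D (v σ) (i , j) (l , k)) - rkσ σ (i , j) ≡ rkσ σ (l , k) + D (u σ) (i , j) (l , k)
  key = corner-identity (rkσ σ (i , j)) (rkσ σ (l , k)) (rkσ σ (l , j))
                        (D (v σ) (i , j) (l , k)) (D (u σ) (i , j) (l , k)) (rect-rkσ σ i j l k) ik∈X

private
  extend-down : ∀ {P : ℕ → Bool} {k r} → P k ≡ false →
    (∀ {l} → suc k ≤ l → l < r → ¬ T (P l)) → ∀ {l} → k ≤ l → l < r → ¬ T (P l)
  extend-down Pk above k≤l l<r with ℕ.m≤n⇒m<n∨m≡n k≤l
  ... | inj₁ k<l  = above k<l l<r
  ... | inj₂ refl = subst T Pk

firstIn-spec : ∀ (P : ℕ → Bool) d k m → let r = firstIn P d k m in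
  (k ≤ r × r < k ℕ.+ m × T (P r) × (∀ {l} → k ≤ l → l < r → ¬ T (P l)))
  ⊎ (r ≡ d × (∀ {l} → k ≤ l → l < k ℕ.+ m → ¬ T (P l)))
firstIn-spec P d k zero =
  inj₂ (refl , λ k≤l l<k+0 → ⊥-elim (ℕ.<⇒≱ (ℕ.<-≤-trans l<k+0 (ℕ.≤-reflexive (ℕ.+-identityʳ k))) k≤l))
firstIn-spec P d k (suc m) with P k in Pk
... | true = inj₁ (ℕ.≤-refl , ℕ.m<m+n k ℕ.z<s , subst T (sym Pk) _ , λ k≤l l<k → ⊥-elim (ℕ.<⇒≱ l<k k≤l))
... | false with firstIn-spec P d (suc k) m
...   | inj₁ (k<r , r<end , Pr , least) =
        inj₁ (ℕ.<⇒≤ k<r , ℕ.<-≤-trans r<end (ℕ.≤-reflexive (sym (ℕ.+-suc k m))) , Pr , extend-down Pk least)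
...   | inj₂ (r≡d , none) =
        inj₂ (r≡d , extend-down Pk (λ k<l l<end → none k<l (ℕ.<-≤-trans l<end (ℕ.≤-reflexive (ℕ.+-suc k m)))))

-- jplus and both coordinates of pplus are firstAfter-searches; iplus is a lastFrom-search.
firstAfter : ℕ → (ℕ → Bool) → ℕ → ℕ
firstAfter n P j = firstIn P n (suc j) (n ∸ j)

private
  range-end : ∀ {j n} → j ≤ n → suc j ℕ.+ (n ∸ j) ≡ suc n
  range-end j≤n = cong suc (ℕ.m+[n∸m]≡n j≤n)

firstAfter-spec : ∀ {n} (P : ℕ → Bool) {j} → j ≤ n → let r = firstAfter n P j in
  (j < r × r ≤ n × T (P r) × (∀ {l} → j < l → l < r → ¬ T (P l)))
  ⊎ (r ≡ n × (∀ {l} → j < l → l ≤ n → ¬ T (P l)))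
firstAfter-spec {n} P {j} j≤n with firstIn-spec P n (suc j) (n ∸ j)
... | inj₁ (j<r , r<end , Pr , least) =
  inj₁ (j<r , ℕ.s≤s⁻¹ (ℕ.<-≤-trans r<end (ℕ.≤-reflexive (range-end j≤n))) , Pr , least)
... | inj₂ (r≡n , none) =
  inj₂ (r≡n , λ j<l l≤n → none j<l (ℕ.<-≤-trans (s≤s l≤n) (ℕ.≤-reflexive (sym (range-end j≤n)))))

firstAfter-found : ∀ {n} (P : ℕ → Bool) {j s} → j < s → s ≤ n → T (P s) → let r = firstAfter n P j in
  j < r × r ≤ s × T (P r) × (∀ {l} → j < l → l < r → ¬ T (P l))
firstAfter-found P j<s s≤n Ps with firstAfter-spec P (ℕ.<⇒≤ (ℕ.<-≤-trans j<s s≤n))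
... | inj₁ (j<r , _ , Pr , least) = j<r , ℕ.≮⇒≥ (λ s<r → least j<s s<r Ps) , Pr , least
... | inj₂ (_ , none) = ⊥-elim (none j<s s≤n Ps)

firstAfter-unique : ∀ {n} (P : ℕ → Bool) {j r} → j < r → r ≤ n → T (P r) →
  (∀ {l} → j < l → l < r → ¬ T (P l)) → firstAfter n P j ≡ r
firstAfter-unique P j<r r≤n Pr none-before with firstAfter-found P j<r r≤n Pr
... | j<r₀ , r₀≤r , Pr₀ , _ = ℕ.≤-antisym r₀≤r (ℕ.≮⇒≥ (λ r₀<r → none-before j<r₀ r₀<r Pr₀))

lastIn-greatest : ∀ (P : ℕ → Bool) d k m {s} → s ≤ k → k ≤ s ℕ.+ m → T (P s) →
  let r = lastIn P d k (suc m) in s ≤ r × r ≤ k × T (P r)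
lastIn-greatest P d k m s≤k k≤s+m Ps with P k in Pk | ℕ.m≤n⇒m<n∨m≡n s≤k
... | true  | _         = s≤k , ℕ.≤-refl , subst T (sym Pk) _
... | false | inj₂ refl = ⊥-elim (subst T Pk Ps)
lastIn-greatest P d k zero {s} s≤k k≤s+0 Ps | false | inj₁ s<k =
  ⊥-elim (ℕ.<⇒≱ s<k (subst (k ≤_) (ℕ.+-identityʳ s) k≤s+0))
lastIn-greatest P d (suc k) (suc m) {s} s≤k k≤s+m Ps | false | inj₁ s<k
  with lastIn-greatest P d k m (ℕ.s≤s⁻¹ s<k) (ℕ.s≤s⁻¹ (subst (suc k ≤_) (ℕ.+-suc s m) k≤s+m)) Ps
... | s≤r , r≤k , Pr = s≤r , ℕ.m≤n⇒m≤1+n r≤k , Pr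

lastFrom : ℕ → (ℕ → Bool) → ℕ → ℕ
lastFrom n P i = lastIn P i n (suc (n ∸ i))

lastFrom-greatest : ∀ {n} (P : ℕ → Bool) {i s} → i ≤ s → s ≤ n → T (P s) →
  let r = lastFrom n P i in s ≤ r × r ≤ n × T (P r)
lastFrom-greatest {n} P {i} {s} i≤s s≤n = lastIn-greatest P i n (n ∸ i) s≤n
  (subst (_≤ s ℕ.+ (n ∸ i)) (ℕ.m+[n∸m]≡n (ℕ.≤-trans i≤s s≤n)) (ℕ.+-monoˡ-≤ (n ∸ i) i≤s))

iplus-greatest : ∀ {n} (σ : Pair n) {i j s} → let j⁺ = jplus σ (i , j) ; r = iplus σ (i , j) in
  i ≤ s → s ≤ n → InX σ (s , j⁺) → D (u σ) (i , j) (s , j⁺) ≡ 0ℤ →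
  s ≤ r × r ≤ n × InX σ (r , j⁺) × D (u σ) (i , j) (r , j⁺) ≡ 0ℤ
iplus-greatest {n} σ {i} {j} {s} i≤s s≤n s∈X Ds≡0 =
  proj₁ found , proj₁ (proj₂ found) , toWitness (proj₁ r-qualifies) , toWitness (proj₂ r-qualifies)
  where
  j⁺ r : ℕ
  j⁺ = jplus σ (i , j)
  r = iplus σ (i , j)
  qualifies : ℕ → Bool
  qualifies l = inXᵇ σ (l , j⁺) ∧ ⌊ D (u σ) (i , j) (l , j⁺) ℤ.≟ + 0 ⌋
  found : s ≤ r × r ≤ n × T (qualifies r)
  found = lastFrom-greatest qualifies i≤s s≤n
    (from (T-∧ {inXᵇ σ (s , j⁺)}) (fromWitness s∈X , fromWitness Ds≡0))
  r-qualifies : T (inXᵇ σ (r , j⁺)) × T ⌊ D (u σ) (i , j) (r , j⁺) ℤ.≟ + 0 ⌋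
  r-qualifies = to (T-∧ {inXᵇ σ (r , j⁺)}) (proj₂ (proj₂ found))

module Transposition {n : ℕ} (τ : Pair n) {a b : Fin n} (a≢b : a ≢ b) (tR : InR τ a b) where

  τₜ : Pair n
  τₜ = τ[ τ , a ] b tR

  α β : ℕ → Bool
  α = separates a b
  β = separates (v τ ⟨$⟩ʳ a) (v τ ⟨$⟩ʳ b)

  δ : Point → ℕ
  δ (l , k) = 𝟙[ α l ∧ β k ]

  δ-one : ∀ {l k} → T (α l) → T (β k) → δ (l , k) ≡ 1
  δ-one {l} αl βk = 𝟙-T (from (T-∧ {α l}) (αl , βk))

  δ-zeroˡ : ∀ {l k} → ¬ T (α l) → δ (l , k) ≡ 0
  δ-zeroˡ {l} ¬αl = 𝟙-¬T (¬αl ∘ proj₁ ∘ to (T-∧ {α l}))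

  δ-zeroʳ : ∀ {l k} → ¬ T (β k) → δ (l , k) ≡ 0
  δ-zeroʳ {l} ¬βk = 𝟙-¬T (¬βk ∘ proj₂ ∘ to (T-∧ {α l}))

  rkℤ-transpose : ∀ {p} → InBox n p → rkℤ (v τ) p ≡ rkℤ (v τₜ) p + + δ p
  rkℤ-transpose {l , k} lk∈□ = trans
    (cong +_ (rk-·t (v τ) a≢b {l} {k} (proj₁ (proj₁ tR) (l , k) lk∈□)))
    (ℤ.pos-+ (rk (v τₜ) (l , k)) (δ (l , k)))

  rkσ-transpose : ∀ {p} → InBox n p → rkσ τ p ≡ rkσ τₜ p + + δ p
  rkσ-transpose {p} p∈□ =
    trans (cong (_- rkℤ (u τ) p) (rkℤ-transpose p∈□)) (identity (rkℤ (v τₜ) p) (rkℤ (u τ) p) (+ δ p))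
    where
    identity : ∀ x w d → (x + d) - w ≡ (x - w) + d
    identity = solve-∀

  InX-transpose : ∀ {l k} → InBox n (l , k) → InX τ (l , k) → InX τₜ (l , k) × ¬ T (α l ∧ β k)
  InX-transpose lk∈□ lk∈X
    with +-nonneg-≡0 (rkσ-nonneg τₜ lk∈□) (ℤ.+≤+ z≤n) (trans (sym (rkσ-transpose lk∈□)) lk∈X)
  ... | lk∈Xₜ , δ≡0 = lk∈Xₜ , +𝟙≡0⇒¬T δ≡0

  rkσ≡δ : ∀ {l k} → InBox n (l , k) → InX τₜ (l , k) → rkσ τ (l , k) ≡ + δ (l , k)
  rkσ≡δ {l} {k} lk∈□ lk∈Xₜ =
    trans (rkσ-transpose lk∈□) (trans (cong (_+ + δ (l , k)) lk∈Xₜ) (ℤ.+-identityˡ (+ δ (l , k))))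

  ∉X-transpose : ∀ {l k} → InBox n (l , k) → InX τₜ (l , k) → ¬ InX τ (l , k) →
    T (α l) × T (β k) × rkσ τ (l , k) ≡ 1ℤ
  ∉X-transpose {l} {k} lk∈□ lk∈Xₜ lk∉X with T? (α l ∧ β k)
  ... | yes αβ = proj₁ (to T-∧ αβ) , proj₂ (to T-∧ αβ) , trans (rkσ≡δ lk∈□ lk∈Xₜ) (cong +_ (𝟙-T αβ))
  ... | no ¬αβ = ⊥-elim (lk∉X (trans (rkσ≡δ lk∈□ lk∈Xₜ) (cong +_ (𝟙-¬T ¬αβ))))

  D-transpose-jump : ∀ {i j l k} → InBox n (i , j) → InBox n (l , k) →
    T (α i) → ¬ T (α l) → T (β j) → ¬ T (β k) →
    D (v τ) (i , j) (l , k) ≡ D (v τₜ) (i , j) (l , k) + 1ℤ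
  D-transpose-jump {i} {j} {l} {k} ij∈□ lk∈□ αi ¬αl βj ¬βk =
    trans (rect-shift {g = rkℤ (v τₜ)} (+_ ∘ δ) rkℤ-transpose ij∈□ lk∈□)
          (cong (_+_ (D (v τₜ) (i , j) (l , k))) rect-δ)
    where
    open ≡-Reasoning
    rect-δ : rect (+_ ∘ δ) (i , j) (l , k) ≡ 1ℤ
    rect-δ = begin
      (+ δ (i , j) + + δ (l , k)) - + δ (i , k) - + δ (l , j)
        ≡⟨ cong₂ (λ x y → (+ x + + y) - + δ (i , k) - + δ (l , j)) (δ-one {i} {j} αi βj) (δ-zeroˡ {l} {k} ¬αl) ⟩
      (1ℤ + 0ℤ) - + δ (i , k) - + δ (l , j)
        ≡⟨ cong₂ (λ x y → (1ℤ + 0ℤ) - + x - + y) (δ-zeroʳ {i} {k} ¬βk) (δ-zeroˡ {l} {j} ¬αl) ⟩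
      1ℤ ∎

  module AtPoint {i j : ℕ} (i≤n : i ≤ n) (j≤n : j ≤ n)
                 (q∉X : ¬ InX τ (pto τₜ (i , j))) (Rq : Rto τ (pto τₜ (i , j))) where

    w x x′ : Perm n
    w = u τ
    x = v τ
    x′ = v τₜ

    j⁺ i′ j′ i⁺ₜ i⁺ : ℕ
    j⁺ = jplus τₜ (i , j)
    i′ = proj₁ (pplus τ (i , j⁺))
    j′ = proj₂ (pplus τ (i , j⁺))
    i⁺ₜ = iplus τₜ (i , j)
    i⁺ = iplus τ (i , j)

    j⁺≢n : j⁺ ≢ n
    j⁺≢n j⁺≡n = q∉X (subst (λ k → InX τ (i , k)) (sym j⁺≡n) (InX-lastColumn τ i))

    j⁺-spec : j < j⁺ × j⁺ < n × InX τₜ (i , j⁺) × (∀ {l} → j < l → l < j⁺ → ¬ InX τₜ (i , l))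
    j⁺-spec with firstAfter-spec (λ k → inXᵇ τₜ (i , k)) j≤n
    ... | inj₂ (j⁺≡n , _) = ⊥-elim (j⁺≢n j⁺≡n)
    ... | inj₁ (j<j⁺ , j⁺≤n , j⁺∈Xₜ , least) =
      j<j⁺ , ℕ.≤∧≢⇒< j⁺≤n j⁺≢n , toWitness j⁺∈Xₜ , λ j<l l<j⁺ → least j<l l<j⁺ ∘ fromWitness

    j≤j⁺ : j ≤ j⁺
    j≤j⁺ = ℕ.<⇒≤ (proj₁ j⁺-spec)

    j⁺<n : j⁺ < n
    j⁺<n = proj₁ (proj₂ j⁺-spec)

    q∈Xₜ : InX τₜ (i , j⁺)
    q∈Xₜ = proj₁ (proj₂ (proj₂ j⁺-spec))

    q-jump : T (α i) × T (β j⁺) × rkσ τ (i , j⁺) ≡ 1ℤ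
    q-jump = ∉X-transpose (i≤n , ℕ.<⇒≤ j⁺<n) q∈Xₜ q∉X

    αi : T (α i)
    αi = proj₁ q-jump

    βj⁺ : T (β j⁺)
    βj⁺ = proj₁ (proj₂ q-jump)

    rk-q≡1 : rkσ τ (i , j⁺) ≡ 1ℤ
    rk-q≡1 = proj₂ (proj₂ q-jump)

    j′-spec : j⁺ < j′ × j′ ≤ n × T (inXᵇ τ (i , j′)) × (∀ {l} → j⁺ < l → l < j′ → ¬ T (inXᵇ τ (i , l)))
    j′-spec = firstAfter-found (λ k → inXᵇ τ (i , k)) j⁺<n ℕ.≤-refl (fromWitness (InX-lastColumn τ i))

    j⁺≤j′ : j⁺ ≤ j′
    j⁺≤j′ = ℕ.<⇒≤ (proj₁ j′-spec)

    j≤j′ : j ≤ j′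
    j≤j′ = ℕ.≤-trans j≤j⁺ j⁺≤j′

    j′≤n : j′ ≤ n
    j′≤n = proj₁ (proj₂ j′-spec)

    ij′∈X : InX τ (i , j′)
    ij′∈X = toWitness (proj₁ (proj₂ (proj₂ j′-spec)))

    ¬βj′ : ¬ T (β j′)
    ¬βj′ βj′ = proj₂ (InX-transpose (i≤n , j′≤n) ij′∈X) (from (T-∧ {α i}) (αi , βj′))

    jplus-τ : jplus τ (i , j) ≡ j′
    jplus-τ = firstAfter-unique (λ k → inXᵇ τ (i , k)) (ℕ.≤-<-trans j≤j⁺ (proj₁ j′-spec)) j′≤n
      (proj₁ (proj₂ (proj₂ j′-spec))) none-before
      where
      none-before : ∀ {l} → j < l → l < j′ → ¬ T (inXᵇ τ (i , l))
      none-before {l} j<l l<j′ with ℕ.<-cmp l j⁺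
      ... | tri< l<j⁺ _ _ =
        proj₂ (proj₂ (proj₂ j⁺-spec)) j<l l<j⁺ ∘ proj₁ ∘ InX-transpose (i≤n , l≤n) ∘ toWitness
        where
        l≤n : l ≤ n
        l≤n = ℕ.<⇒≤ (ℕ.<-trans l<j⁺ j⁺<n)
      ... | tri≈ _ refl _ = q∉X ∘ toWitness
      ... | tri> _ _ j⁺<l = proj₂ (proj₂ (proj₂ j′-spec)) j⁺<l l<j′

    i′-spec : i ≤ i′ × i′ ≤ n × ¬ T (α i′)
    i′-spec with firstAfter-spec (λ l → inXᵇ τ (l , j⁺)) i≤n
    ... | inj₁ (i<i′ , i′≤n , i′j⁺∈X , _) =
      ℕ.<⇒≤ i<i′ , i′≤n , λ αi′ → proj₂ (InX-transpose (i′≤n , ℕ.<⇒≤ j⁺<n) (toWitness i′j⁺∈X))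
                                          (from (T-∧ {α i′}) (αi′ , βj⁺))
    ... | inj₂ (i′≡n , _) =
      subst (i ≤_) (sym i′≡n) i≤n , ℕ.≤-reflexive i′≡n , subst (¬_ ∘ T ∘ α) (sym i′≡n) (separates-last a b)

    i≤i′ : i ≤ i′
    i≤i′ = proj₁ i′-spec

    i′≤n : i′ ≤ n
    i′≤n = proj₁ (proj₂ i′-spec)

    ¬αi′ : ¬ T (α i′)
    ¬αi′ = proj₂ (proj₂ i′-spec)

    i⁺ₜ-greatest : ∀ {s} → i ≤ s → s ≤ n → InX τₜ (s , j⁺) → D w (i , j) (s , j⁺) ≡ 0ℤ →
      s ≤ i⁺ₜ × i⁺ₜ ≤ n × InX τₜ (i⁺ₜ , j⁺) × D w (i , j) (i⁺ₜ , j⁺) ≡ 0ℤ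
    i⁺ₜ-greatest = iplus-greatest τₜ {i} {j}

    i⁺-greatest : ∀ {s} → i ≤ s → s ≤ n → InX τ (s , j′) → D w (i , j) (s , j′) ≡ 0ℤ →
      s ≤ i⁺ × i⁺ ≤ n × InX τ (i⁺ , j′) × D w (i , j) (i⁺ , j′) ≡ 0ℤ
    i⁺-greatest {s} i≤s s≤n = subst
      (λ k → InX τ (s , k) → D w (i , j) (s , k) ≡ 0ℤ →
             s ≤ i⁺ × i⁺ ≤ n × InX τ (i⁺ , k) × D w (i , j) (i⁺ , k) ≡ 0ℤ)
      jplus-τ (iplus-greatest τ {i} {j} i≤s s≤n)

    i⁺ₜ-spec : i ≤ i⁺ₜ × i⁺ₜ ≤ n × InX τₜ (i⁺ₜ , j⁺) × D w (i , j) (i⁺ₜ , j⁺) ≡ 0ℤ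
    i⁺ₜ-spec = i⁺ₜ-greatest ℕ.≤-refl i≤n q∈Xₜ (rect-sameRow (rkℤ w) i j j⁺)

    i⁺-spec : i ≤ i⁺ × i⁺ ≤ n × InX τ (i⁺ , j′) × D w (i , j) (i⁺ , j′) ≡ 0ℤ
    i⁺-spec = i⁺-greatest ℕ.≤-refl i≤n ij′∈X (rect-sameRow (rkℤ w) i j j′)

    i≤i⁺ₜ : i ≤ i⁺ₜ
    i≤i⁺ₜ = proj₁ i⁺ₜ-spec

    i⁺ₜ≤n : i⁺ₜ ≤ n
    i⁺ₜ≤n = proj₁ (proj₂ i⁺ₜ-spec)

    Dw-i⁺ₜj⁺≡0 : D w (i , j) (i⁺ₜ , j⁺) ≡ 0ℤ
    Dw-i⁺ₜj⁺≡0 = proj₂ (proj₂ (proj₂ i⁺ₜ-spec))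

    i≤i⁺ : i ≤ i⁺
    i≤i⁺ = proj₁ i⁺-spec

    i⁺≤n : i⁺ ≤ n
    i⁺≤n = proj₁ (proj₂ i⁺-spec)

    i⁺≤i⁺ₜ : i⁺ ≤ i⁺ₜ
    i⁺≤i⁺ₜ = proj₁ (i⁺ₜ-greatest i≤i⁺ i⁺≤n i⁺j⁺∈Xₜ (proj₁ Dw-split))
      where
      Dw-split : D w (i , j) (i⁺ , j⁺) ≡ 0ℤ × D w (i , j⁺) (i⁺ , j′) ≡ 0ℤ
      Dw-split = to (D-≡0-splitCol w j⁺ i≤i⁺ j≤j⁺ j⁺≤j′) (proj₂ (proj₂ (proj₂ i⁺-spec)))
      ij′∈Xₜ : InX τₜ (i , j′)
      ij′∈Xₜ = proj₁ (InX-transpose (i≤n , j′≤n) ij′∈X)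
      i⁺j′∈Xₜ : InX τₜ (i⁺ , j′)
      i⁺j′∈Xₜ = proj₁ (InX-transpose (i⁺≤n , j′≤n) (proj₁ (proj₂ (proj₂ i⁺-spec))))
      rank-eq : rkσ τₜ (i⁺ , j⁺) + D x′ (i , j⁺) (i⁺ , j′) ≡ 0ℤ
      rank-eq = trans (to (corner⇔ τₜ i≤i⁺ j⁺≤j′ (i⁺≤n , j′≤n) ij′∈Xₜ) (i⁺j′∈Xₜ , proj₂ Dw-split)) q∈Xₜ
      i⁺j⁺∈Xₜ : InX τₜ (i⁺ , j⁺)
      i⁺j⁺∈Xₜ = proj₁ (+-nonneg-≡0 (rkσ-nonneg τₜ (i⁺≤n , ℕ.<⇒≤ j⁺<n)) (D-nonneg x′ i≤i⁺ j⁺≤j′) rank-eq)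

    case-∈X : InX τ (i⁺ₜ , j⁺) → Pdown τ (i , j)
    case-∈X i⁺ₜj⁺∈X = ℤ.suc[i]≤j⇒i<j (begin
      1ℤ + rkσ τ (i⁺ , j)                     ≡⟨ cong (_+ rkσ τ (i⁺ , j)) Rq ⟨
      D x (i , j⁺) (i′ , j′) + rkσ τ (i⁺ , j)  ≤⟨ ℤ.+-monoˡ-≤ (rkσ τ (i⁺ , j))
                                                    (D-mono x ℕ.≤-refl j≤j⁺ i≤i′ j⁺≤j′ i′≤i⁺ ℕ.≤-refl) ⟩
      D x (i , j) (i⁺ , j′) + rkσ τ (i⁺ , j)   ≡⟨ ℤ.+-comm (D x (i , j) (i⁺ , j′)) (rkσ τ (i⁺ , j)) ⟩
      rkσ τ (i⁺ , j) + D x (i , j) (i⁺ , j′)   ≡⟨ to (corner⇔ τ i≤i⁺ j≤j′ (i⁺≤n , j′≤n) ij′∈X)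
                                                     (proj₂ (proj₂ i⁺-spec)) ⟩
      rkσ τ (i , j)                            ∎)
      where
      open ℤ.≤-Reasoning
      i<i⁺ₜ : i < i⁺ₜ
      i<i⁺ₜ = ℕ.≤∧≢⇒< i≤i⁺ₜ (λ i≡i⁺ₜ → q∉X (subst (λ l → InX τ (l , j⁺)) (sym i≡i⁺ₜ) i⁺ₜj⁺∈X))
      i′-found : i < i′ × i′ ≤ i⁺ₜ × T (inXᵇ τ (i′ , j⁺)) × (∀ {l} → i < l → l < i′ → ¬ T (inXᵇ τ (l , j⁺)))
      i′-found = firstAfter-found (λ l → inXᵇ τ (l , j⁺)) i<i⁺ₜ i⁺ₜ≤n (fromWitness i⁺ₜj⁺∈X)
      Dw-i′j⁺≡0 : D w (i , j) (i′ , j⁺) ≡ 0ℤ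
      Dw-i′j⁺≡0 = proj₁ (to (D-≡0-splitRow w i′ i≤i′ (proj₁ (proj₂ i′-found)) j≤j⁺) Dw-i⁺ₜj⁺≡0)
      q⁺-corner : InX τ (i′ , j′) × D w (i , j⁺) (i′ , j′) ≡ 0ℤ
      q⁺-corner = from (corner⇔ τ i≤i′ j⁺≤j′ (i′≤n , j′≤n) ij′∈X)
        (trans (cong₂ _+_ (toWitness (proj₁ (proj₂ (proj₂ i′-found)))) Rq) (sym rk-q≡1))
      i′≤i⁺ : i′ ≤ i⁺
      i′≤i⁺ = proj₁ (i⁺-greatest i≤i′ i′≤n (proj₁ q⁺-corner)
        (from (D-≡0-splitCol w j⁺ i≤i′ j≤j⁺ j⁺≤j′) (Dw-i′j⁺≡0 , proj₂ q⁺-corner)))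

    i⁺ₜ-jump : ¬ InX τ (i⁺ₜ , j⁺) → T (α i⁺ₜ) × T (β j⁺) × rkσ τ (i⁺ₜ , j⁺) ≡ 1ℤ
    i⁺ₜ-jump = ∉X-transpose (i⁺ₜ≤n , ℕ.<⇒≤ j⁺<n) (proj₁ (proj₂ (proj₂ i⁺ₜ-spec)))

    i⁺ₜ≤i⁺ : ¬ InX τ (i⁺ₜ , j⁺) → i⁺ₜ ≤ i⁺
    i⁺ₜ≤i⁺ i⁺ₜj⁺∉X = proj₁ (i⁺-greatest i≤i⁺ₜ i⁺ₜ≤n (proj₁ corner)
      (from (D-≡0-splitCol w j⁺ i≤i⁺ₜ j≤j⁺ j⁺≤j′) (Dw-i⁺ₜj⁺≡0 , proj₂ corner)))
      where
      open ≡-Reasoning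
      αi⁺ₜ : T (α i⁺ₜ)
      αi⁺ₜ = proj₁ (i⁺ₜ-jump i⁺ₜj⁺∉X)
      i⁺ₜ≤i′ : i⁺ₜ ≤ i′
      i⁺ₜ≤i′ = ℕ.≮⇒≥ λ i′<i⁺ₜ → ¬αi′ (separates-convex i≤i′ (ℕ.<⇒≤ i′<i⁺ₜ) αi αi⁺ₜ)
      Dx-split : D x (i , j⁺) (i⁺ₜ , j′) + (D x′ (i⁺ₜ , j⁺) (i′ , j′) + 1ℤ) ≡ 1ℤ
      Dx-split = begin
        D x (i , j⁺) (i⁺ₜ , j′) + (D x′ (i⁺ₜ , j⁺) (i′ , j′) + 1ℤ)
          ≡⟨ cong (_+_ (D x (i , j⁺) (i⁺ₜ , j′)))
                  (D-transpose-jump (i⁺ₜ≤n , ℕ.<⇒≤ j⁺<n) (i′≤n , j′≤n) αi⁺ₜ ¬αi′ βj⁺ ¬βj′) ⟨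
        D x (i , j⁺) (i⁺ₜ , j′) + D x (i⁺ₜ , j⁺) (i′ , j′)
          ≡⟨ rect-splitRow (rkℤ x) {i} {j⁺} {i′} {j′} i⁺ₜ ⟨
        D x (i , j⁺) (i′ , j′)
          ≡⟨ Rq ⟩
        1ℤ ∎
      Dx≡0 : D x (i , j⁺) (i⁺ₜ , j′) ≡ 0ℤ
      Dx≡0 = nonneg-summand≡0 (D-nonneg x i≤i⁺ₜ j⁺≤j′) (D-nonneg x′ i⁺ₜ≤i′ j⁺≤j′) Dx-split
      corner : InX τ (i⁺ₜ , j′) × D w (i , j⁺) (i⁺ₜ , j′) ≡ 0ℤ
      corner = from (corner⇔ τ i≤i⁺ₜ j⁺≤j′ (i⁺ₜ≤n , j′≤n) ij′∈X)
        (trans (cong₂ _+_ (proj₂ (proj₂ (i⁺ₜ-jump i⁺ₜj⁺∉X))) Dx≡0) (sym rk-q≡1))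

    case-∉X : ¬ InX τ (i⁺ₜ , j⁺) →
      (pdown τ (i , j) ≡ pdown τₜ (i , j)) × (Pdown τ (i , j) ⇔ Pdown τₜ (i , j))
    case-∉X i⁺ₜj⁺∉X = cong (_, j) i⁺≡i⁺ₜ , Pdown⇔
      where
      open ≡-Reasoning
      i⁺≡i⁺ₜ : i⁺ ≡ i⁺ₜ
      i⁺≡i⁺ₜ = ℕ.≤-antisym i⁺≤i⁺ₜ (i⁺ₜ≤i⁺ i⁺ₜj⁺∉X)
      rk-p↓ : rkσ τ (i⁺ , j) ≡ rkσ τₜ (i⁺ₜ , j) + + δ (i , j)
      rk-p↓ = begin
        rkσ τ (i⁺ , j)                    ≡⟨ cong (λ r → rkσ τ (r , j)) i⁺≡i⁺ₜ ⟩
        rkσ τ (i⁺ₜ , j)                   ≡⟨ rkσ-transpose (i⁺ₜ≤n , j≤n) ⟩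
        rkσ τₜ (i⁺ₜ , j) + + δ (i⁺ₜ , j)  ≡⟨ cong (λ s → rkσ τₜ (i⁺ₜ , j) + + 𝟙[ s ∧ β j ])
                                                 (trans (T⇒≡true (proj₁ (i⁺ₜ-jump i⁺ₜj⁺∉X))) (sym (T⇒≡true αi))) ⟩
        rkσ τₜ (i⁺ₜ , j) + + δ (i , j)    ∎
      Pdown⇔ : (rkσ τ (i⁺ , j) ℤ.< rkσ τ (i , j)) ⇔ (rkσ τₜ (i⁺ₜ , j) ℤ.< rkσ τₜ (i , j))
      Pdown⇔ = subst₂ (λ A B → (A ℤ.< B) ⇔ (rkσ τₜ (i⁺ₜ , j) ℤ.< rkσ τₜ (i , j)))
        (sym rk-p↓) (sym (rkσ-transpose (i≤n , j≤n))) (+-cancelʳ-<-⇔ (+ δ (i , j)))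

lemma4p8 : {n : ℕ} (τ : Pair n) (a b : Fin n) → a ≢ b → (tR : InR τ a b)
    → (p : Point) → InBox n p → ¬ InX τ p
    → ¬ InX τ (pto (τ[ τ , a ] b tR) p)
    → Rto τ (pto (τ[ τ , a ] b tR) p)
    → (InX τ (pse (τ[ τ , a ] b tR) p) → Pdown τ p)
      × (¬ InX τ (pse (τ[ τ , a ] b tR) p)
         → (pdown τ p ≡ pdown (τ[ τ , a ] b tR) p)
           × (Pdown τ p ⇔ Pdown (τ[ τ , a ] b tR) p))
lemma4p8 τ a b a≢b tR (i , j) (i≤n , j≤n) _ q∉X Rq = case-∈X , case-∉X
  where open Transposition.AtPoint τ a≢b tR i≤n j≤n q∉X Rq
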